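{- Let $M\in\mathbb{Z}^{m\times n}$ be a minimal matrix (the smallest element of its Hadamard equivalence class with respect to the row-lex ordering). Then every nonzero row of $M$ and every nonzero column of $M$ begins with a negative entry.
   Context: Integer vectors in $\mathbb{Z}^n$ are ordered lexicographically: $v<w$ iff there is $j$ with $v_i=w_i$ for all $i<j$ and $v_j<w_j$. The row-lex ordering $\le_R$ on $\mathbb{Z}^{m\times n}$ is the lexicographic extension of this ordering to matrices viewed as the sequence of their rows (first row most significant). Two matrices in $\mathbb{Z}^{m\times n}$ are Hadamard equivalent if one can be obtained from the other by a sequence of the operations: multiplying a row or a column by $-1$; swapping two rows or two columns. A matrix $M$ is minimal if it equals the $\le_R$-minimum of its Hadamard equivalence class. A vector $v$ begins with a negative entry if for some $j$, $v_1=\dots=v_{j-1}=0$ and $v_j<0$. -}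

module Defs where

open import Data.Nat using (ℕ)
open import Data.Fin using (Fin; _<_; _≟_)
open import Data.Integer using (ℤ; -_; 0ℤ) renaming (_<_ to _<ℤ_)
open import Data.Product using (Σ; _×_; ∃-syntax)
open import Data.Sum using (_⊎_)
open import Relation.Nullary using (¬_; yes; no)
open import Relation.Binary.PropositionalEquality using (_≡_)

Matrix : ℕ → ℕ → Set
Matrix m n = Fin m → Fin n → ℤ

LexLt : {A : Set} {k : ℕ} → (A → A → Set) → (Fin k → A) → (Fin k → A) → Set
LexLt {k = k} _≺_ v w = ∃[ j ] ((∀ (i : Fin k) → i < j → v i ≡ w i) × (v j ≺ w j))

VecLt : {n : ℕ} → (Fin n → ℤ) → (Fin n → ℤ) → Set
VecLt = LexLt _<ℤ_

_≤R_ : {m n : ℕ} → Matrix m n → Matrix m n → Set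
M ≤R N = M ≡ N ⊎ LexLt VecLt M N

swapIdx : {k : ℕ} → Fin k → Fin k → Fin k → Fin k
swapIdx i j r with r ≟ i
... | yes _ = j
... | no _ with r ≟ j
...   | yes _ = i
...   | no _ = r

negRow : {m n : ℕ} → Fin m → Matrix m n → Matrix m n
negRow i M r c with r ≟ i
... | yes _ = - M r c
... | no _ = M r c

negCol : {m n : ℕ} → Fin n → Matrix m n → Matrix m n
negCol j M r c with c ≟ j
... | yes _ = - M r c
... | no _ = M r c

swapRows : {m n : ℕ} → Fin m → Fin m → Matrix m n → Matrix m n
swapRows i j M r c = M (swapIdx i j r) c

swapCols : {m n : ℕ} → Fin n → Fin n → Matrix m n → Matrix m n
swapCols i j M r c = M r (swapIdx i j c)

data HadStep {m n : ℕ} (M : Matrix m n) : Matrix m n → Set where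
  negRowStep  : (i : Fin m) → HadStep M (negRow i M)
  negColStep  : (j : Fin n) → HadStep M (negCol j M)
  swapRowStep : (i j : Fin m) → HadStep M (swapRows i j M)
  swapColStep : (i j : Fin n) → HadStep M (swapCols i j M)

-- Hadamard equivalence: obtainable by a finite sequence of elementary operations.
-- (Each operation is an involution, so this is already symmetric.)
data HadamardEquiv {m n : ℕ} (M : Matrix m n) : Matrix m n → Set where
  done : HadamardEquiv M M
  step : {N P : Matrix m n} → HadamardEquiv M N → HadStep N P → HadamardEquiv M P

Minimal : {m n : ℕ} → Matrix m n → Set
Minimal M = ∀ N → HadamardEquiv M N → M ≤R N

IsZeroVec : {k : ℕ} → (Fin k → ℤ) → Set
IsZeroVec {k} v = ∀ (i : Fin k) → v i ≡ 0ℤ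

BeginsNegative : {k : ℕ} → (Fin k → ℤ) → Set
BeginsNegative {k} v = ∃[ j ] ((∀ (i : Fin k) → i < j → v i ≡ 0ℤ) × (v j <ℤ 0ℤ))

row : {m n : ℕ} → Matrix m n → Fin m → Fin n → ℤ
row M i = M i

col : {m n : ℕ} → Matrix m n → Fin n → Fin m → ℤ
col M j i = M i j

{-# OPTIONS --safe #-}
module Submission where

open import Defs
open import Data.Nat using (ℕ; s≤s)
open import Data.Fin using (Fin; zero; suc; _<_; _≟_)
open import Data.Fin.Properties using (<-cmp; <⇒≢)
open import Data.Integer using (ℤ; -_; 0ℤ) renaming (_<_ to _<ℤ_)
import Data.Integer.Properties as ℤ
open import Data.Product using (_×_; _,_; ∃-syntax)
open import Data.Sum using (_⊎_; inj₁; inj₂)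
open import Data.Empty using (⊥-elim)
open import Function using (_$_; _∘_)
open import Relation.Nullary using (¬_; yes; no)
open import Relation.Binary.Definitions using (Irreflexive; tri<; tri≈; tri>)
open import Relation.Binary.PropositionalEquality using (_≡_; _≢_; refl; sym; trans; cong; ≢-sym)

-- If the first nonzero entry of a row (column) of M were positive, negating that
-- row (column) would give a Hadamard-equivalent matrix that agrees with M up to
-- that entry in row-major order and is smaller there, so it would lie strictly
-- below M in the row-lex order.

module _ {A : Set} (_≺_ : A → A → Set) where

  ¬LexLt-pointwise : Irreflexive _≡_ _≺_ → ∀ {k} {v w : Fin k → A} →
    (∀ i → v i ≡ w i) → ¬ LexLt _≺_ v w
  ¬LexLt-pointwise irrefl v≗w (j , _ , vj≺wj) = irrefl (v≗w j) vj≺wj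

  ¬LexLt-blockedAt : ∀ {k} {v w : Fin k → A} (j : Fin k) →
    (∀ i → i < j → ¬ v i ≺ w i) → ¬ v j ≺ w j → v j ≢ w j → ¬ LexLt _≺_ v w
  ¬LexLt-blockedAt j before ¬vj≺wj vj≢wj (r , agree , vr≺wr) with <-cmp r j
  ... | tri< r<j _ _ = before r r<j vr≺wr
  ... | tri≈ _ refl _ = ¬vj≺wj vr≺wr
  ... | tri> _ _ j<r = vj≢wj (agree j j<r)

module _ {m n : ℕ} where

  FirstDecreaseAt : Matrix m n → Matrix m n → Fin m → Fin n → Set
  FirstDecreaseAt M N i j =
    (∀ r → r < i → ∀ c → N r c ≡ M r c) ×
    (∀ c → c < j → N i c ≡ M i c) ×
    N i j <ℤ M i j

  -- Stated as a refutation of M ≤R N rather than as N <R M: the latter would need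
  -- equality of agreeing rows, which are functions, i.e. function extensionality.
  FirstDecreaseAt⇒≰R : ∀ {M N i j} → FirstDecreaseAt M N i j → ¬ M ≤R N
  FirstDecreaseAt⇒≰R (_ , _ , Nij<Mij) (inj₁ refl) = ℤ.<-irrefl refl Nij<Mij
  FirstDecreaseAt⇒≰R {M} {N} {i} {j} (rowsAgree , entriesAgree , Nij<Mij) (inj₂ M<N) =
    ¬LexLt-blockedAt VecLt i
      (λ r r<i → ¬LexLt-pointwise _<ℤ_ ℤ.<-irrefl (λ c → sym (rowsAgree r r<i c)))
      (¬LexLt-blockedAt _<ℤ_ j
        (λ c c<j → ℤ.<-irrefl (sym (entriesAgree c c<j)))
        (ℤ.<-asym Nij<Mij)
        Mij≢Nij)
      (λ Mi≡Ni → Mij≢Nij (cong (_$ j) Mi≡Ni))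
      M<N
    where
    Mij≢Nij : M i j ≢ N i j
    Mij≢Nij = ≢-sym (ℤ.<⇒≢ Nij<Mij)

  minimal⇒¬FirstDecreaseAt : ∀ {M N i j} → Minimal M → HadamardEquiv M N →
    ¬ FirstDecreaseAt M N i j
  minimal⇒¬FirstDecreaseAt minimal M~N decrease =
    FirstDecreaseAt⇒≰R decrease (minimal _ M~N)

module _ {k : ℕ} where

  ZeroBefore : (Fin k → ℤ) → Fin k → Set
  ZeroBefore v j = ∀ i → i < j → v i ≡ 0ℤ

  BeginsPositive : (Fin k → ℤ) → Set
  BeginsPositive v = ∃[ j ] (ZeroBefore v j × 0ℤ <ℤ v j)

firstNonZero : ∀ {k} (v : Fin k → ℤ) → ¬ IsZeroVec v →
  ∃[ j ] (ZeroBefore v j × v j ≢ 0ℤ)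
firstNonZero {ℕ.zero} v v≢0 = ⊥-elim (v≢0 λ ())
firstNonZero {ℕ.suc k} v v≢0 with v zero ℤ.≟ 0ℤ
... | no v₀≢0 = zero , (λ _ ()) , v₀≢0
... | yes v₀≡0 = shift (firstNonZero (v ∘ suc) (v≢0 ∘ extend))
  where
  extend : IsZeroVec (v ∘ suc) → IsZeroVec v
  extend _ zero = v₀≡0
  extend tail≡0 (suc i) = tail≡0 i

  shift : ∃[ j ] (ZeroBefore (v ∘ suc) j × v (suc j) ≢ 0ℤ) →
    ∃[ j ] (ZeroBefore v j × v j ≢ 0ℤ)
  shift (j , zeros , vj≢0) = suc j , zeroBefore , vj≢0
    where
    zeroBefore : ZeroBefore v (suc j)
    zeroBefore zero _ = v₀≡0
    zeroBefore (suc i) (s≤s i<j) = zeros i i<j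

beginsNegative⊎beginsPositive : ∀ {k} (v : Fin k → ℤ) → ¬ IsZeroVec v →
  BeginsNegative v ⊎ BeginsPositive v
beginsNegative⊎beginsPositive v v≢0 with firstNonZero v v≢0
... | j , zeros , vj≢0 with ℤ.<-cmp (v j) 0ℤ
...   | tri< vj<0 _ _ = inj₁ (j , zeros , vj<0)
...   | tri≈ _ vj≡0 _ = ⊥-elim (vj≢0 vj≡0)
...   | tri> _ _ 0<vj = inj₂ (j , zeros , 0<vj)

neg-<-pos : ∀ {a} → 0ℤ <ℤ a → - a <ℤ a
neg-<-pos 0<a = ℤ.<-trans (ℤ.neg-mono-< 0<a) 0<a

neg-zero : ∀ {a} → a ≡ 0ℤ → - a ≡ a
neg-zero refl = refl

module _ {m n : ℕ} (M : Matrix m n) where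

  negRow-self : ∀ i c → negRow i M i c ≡ - M i c
  negRow-self i c with i ≟ i
  ... | yes _ = refl
  ... | no i≢i = ⊥-elim (i≢i refl)

  negRow-other : ∀ {i r} c → r ≢ i → negRow i M r c ≡ M r c
  negRow-other {i} {r} c r≢i with r ≟ i
  ... | yes r≡i = ⊥-elim (r≢i r≡i)
  ... | no _ = refl

  negCol-self : ∀ j r → negCol j M r j ≡ - M r j
  negCol-self j r with j ≟ j
  ... | yes _ = refl
  ... | no j≢j = ⊥-elim (j≢j refl)

  negCol-other : ∀ {j c} r → c ≢ j → negCol j M r c ≡ M r c
  negCol-other {j} {c} r c≢j with c ≟ j
  ... | yes c≡j = ⊥-elim (c≢j c≡j)
  ... | no _ = refl

  negCol-fixes-row : ∀ j r → M r j ≡ 0ℤ → ∀ c → negCol j M r c ≡ M r c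
  negCol-fixes-row j r Mrj≡0 c with c ≟ j
  ... | yes refl = neg-zero Mrj≡0
  ... | no _ = refl

  negRow-FirstDecreaseAt : ∀ {i j} → ZeroBefore (row M i) j → 0ℤ <ℤ M i j →
    FirstDecreaseAt M (negRow i M) i j
  negRow-FirstDecreaseAt {i} {j} zeros 0<Mij =
      (λ r r<i c → negRow-other c (<⇒≢ r<i))
    , (λ c c<j → trans (negRow-self i c) (neg-zero (zeros c c<j)))
    , ℤ.≤-<-trans (ℤ.≤-reflexive (negRow-self i j)) (neg-<-pos 0<Mij)

  negCol-FirstDecreaseAt : ∀ {i j} → ZeroBefore (col M j) i → 0ℤ <ℤ M i j →
    FirstDecreaseAt M (negCol j M) i j
  negCol-FirstDecreaseAt {i} {j} zeros 0<Mij =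
      (λ r r<i → negCol-fixes-row j r (zeros r r<i))
    , (λ c c<j → negCol-other i (<⇒≢ c<j))
    , ℤ.≤-<-trans (ℤ.≤-reflexive (negCol-self j i)) (neg-<-pos 0<Mij)

mainTheorem1 : ∀ {m n : ℕ} (M : Matrix m n) → Minimal M →
    (∀ (i : Fin m) → ¬ IsZeroVec (row M i) → BeginsNegative (row M i)) ×
    (∀ (j : Fin n) → ¬ IsZeroVec (col M j) → BeginsNegative (col M j))
mainTheorem1 M minimal = rowsBeginNegative , colsBeginNegative
  where
  rowsBeginNegative : ∀ i → ¬ IsZeroVec (row M i) → BeginsNegative (row M i)
  rowsBeginNegative i Mi≢0 with beginsNegative⊎beginsPositive (row M i) Mi≢0
  ... | inj₁ negative = negative
  ... | inj₂ (j , zeros , 0<Mij) = ⊥-elim $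
    minimal⇒¬FirstDecreaseAt minimal (step done (negRowStep i))
      (negRow-FirstDecreaseAt M zeros 0<Mij)

  colsBeginNegative : ∀ j → ¬ IsZeroVec (col M j) → BeginsNegative (col M j)
  colsBeginNegative j M⋆j≢0 with beginsNegative⊎beginsPositive (col M j) M⋆j≢0
  ... | inj₁ negative = negative
  ... | inj₂ (i , zeros , 0<Mij) = ⊥-elim $
    minimal⇒¬FirstDecreaseAt minimal (step done (negColStep j))
      (negCol-FirstDecreaseAt M zeros 0<Mij)
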